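{- Let $\mathfrak{T}=(T,\le)$ be a linear order, $\lhd\in\{\le,<\}$, $\langle a,b\rangle\in\mathrm{int}(\mathfrak{T})$, and let $\varphi$ be an $\mathcal{HS}^\Box_{\mathit{horn}}$-formula. Then $\varphi$ is $\langle a,b\rangle$-satisfiable in $\mathfrak{T}(\lhd)$ if and only if $\bot@\langle x,y\rangle\notin\mathsf{cl}^*(\mathfrak{V}_\varphi)$ for every $\langle x,y\rangle\in\mathrm{int}(\mathfrak{T})$. Furthermore, if some model $\mathfrak{M}$ based on $\mathfrak{T}(\lhd)$ satisfies $\mathfrak{M},\langle a,b\rangle\models\varphi$, then $\mathfrak{K}_\varphi^{\langle a,b\rangle},\langle a,b\rangle\models\varphi$ and, for every $\langle x,y\rangle\in\mathrm{int}(\mathfrak{T})$ and every propositional variable $p$, $\mathfrak{K}_\varphi^{\langle a,b\rangle},\langle x,y\rangle\models p$ implies $\mathfrak{M},\langle x,y\rangle\models p$.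
   Context: Let $\mathfrak{T}=(T,\le)$ be a linear order. An interval is a pair $\langle x,y\rangle$ with $x,y\in T$, $x\le y$ (punctual intervals $\langle x,x\rangle$ allowed); $\mathrm{int}(\mathfrak{T})$ is the set of intervals. Under the irreflexive semantics the twelve interval relations are: $\langle x_1,y_1\rangle \mathsf{A}\langle x_2,y_2\rangle$ iff $y_1=x_2$ and $x_2<y_2$; $\mathsf{B}$: $x_1=x_2$, $y_2<y_1$; $\mathsf{E}$: $x_1<x_2$, $y_1=y_2$; $\mathsf{D}$: $x_1<x_2$, $y_2<y_1$; $\mathsf{L}$: $y_1<x_2$; $\mathsf{O}$: $x_1<x_2<y_1<y_2$; $\bar{\mathsf{A}}$: $y_2=x_1$, $x_2<y_2$; $\bar{\mathsf{B}}$: $x_1=x_2$, $y_1<y_2$; $\bar{\mathsf{E}}$: $x_2<x_1$, $y_1=y_2$; $\bar{\mathsf{D}}$: $x_2<x_1$, $y_1<y_2$; $\bar{\mathsf{L}}$: $y_2<x_1$; $\bar{\mathsf{O}}$: $x_2<x_1<y_2<y_1$. The reflexive semantics replaces every $<$ in these definitions by $\le$. $\mathfrak{T}(<)$ and $\mathfrak{T}(\le)$ denote $\mathfrak{T}$ with the irreflexive, resp. reflexive, semantics. Literals: $\lambda::=\top\mid\bot\mid p\mid\langle\mathsf{R}\rangle\lambda\mid[\mathsf{R}]\lambda$ with $p$ a propositional variable and $\mathsf{R}$ an interval relation. $\mathcal{HS}_{\mathit{horn}}$-formulas: $\varphi::=\lambda\mid[\mathsf{U}](\lambda_1\wedge\dots\wedge\lambda_k\to\lambda)\mid\varphi_1\wedge\varphi_2$;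 conjuncts of the form $\lambda$ are initial conditions, those of the other form clauses. $\mathcal{HS}^\Box_{\mathit{horn}}$ is the set of $\mathcal{HS}_{\mathit{horn}}$-formulas without diamonds $\langle\mathsf{R}\rangle$. A model based on $\mathfrak{T}(\lhd)$ is a valuation $\nu$ of variables into subsets of $\mathrm{int}(\mathfrak{T})$; truth: $\top$ always true, $\bot$ never, $p$ true at $\langle x,y\rangle$ iff $\langle x,y\rangle\in\nu(p)$, $\langle\mathsf{R}\rangle\lambda$ (resp. $[\mathsf{R}]\lambda$) true iff $\lambda$ true at some (resp. every) $\mathsf{R}$-successor, $[\mathsf{U}](\lambda_1\wedge\dots\wedge\lambda_k\to\lambda)$ true iff at every interval where all $\lambda_i$ hold, $\lambda$ holds; $\wedge$ as usual. $\varphi$ is $\langle a,b\rangle$-satisfiable in $\mathfrak{T}(\lhd)$ if some model based on $\mathfrak{T}(\lhd)$ makes $\varphi$ true at $\langle a,b\rangle$. Closure: let $\mathfrak{V}_\varphi=\{\lambda@\langle a,b\rangle\mid\lambda\text{ an initial condition of }\varphi\}\cup\{\top@\langle x,y\rangle\mid\langle x,y\rangle\in\mathrm{int}(\mathfrak{T})\}$ (a set of pairs literal@interval). For a set $\mathfrak{V}$ of such pairs, $\mathsf{cl}(\mathfrak{V})$ is obtained by adding, in one round (non-recursively), for every interval relation $\mathsf{R}$ of $\mathfrak{T}(\lhd)$: (cl1) if $[\mathsf{R}]\lambda@\langle x,y\rangle\in\mathfrak{V}$, all $\lambda@\langle x',y'\rangle$ with $\langle x,y\rangle\mathsf{R}\langle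 x',y'\rangle$; (cl2) if $[\mathsf{R}]\lambda$ occurs in $\varphi$ and $\lambda@\langle x',y'\rangle\in\mathfrak{V}$ for all $\langle x',y'\rangle$ with $\langle x,y\rangle\mathsf{R}\langle x',y'\rangle$, then $[\mathsf{R}]\lambda@\langle x,y\rangle$; (cl3) if $[\mathsf{U}](\lambda_1\wedge\dots\wedge\lambda_k\to\lambda)$ is a clause of $\varphi$ and $\lambda_i@\langle x,y\rangle\in\mathfrak{V}$ for all $i$, then $\lambda@\langle x,y\rangle$. Set $\mathsf{cl}^0(\mathfrak{V}_\varphi)=\mathfrak{V}_\varphi$, $\mathsf{cl}^{\alpha+1}=\mathsf{cl}(\mathsf{cl}^\alpha)$, $\mathsf{cl}^\beta=\bigcup_{\alpha<\beta}\mathsf{cl}^\alpha$ for limit $\beta$, and $\mathsf{cl}^*(\mathfrak{V}_\varphi)=\bigcup_\gamma\mathsf{cl}^\gamma(\mathfrak{V}_\varphi)$ over all ordinals. $\mathfrak{K}_\varphi^{\langle a,b\rangle}$ is the model based on $\mathfrak{T}(\lhd)$ with $\nu(p)=\{\langle x,y\rangle\mid p@\langle x,y\rangle\in\mathsf{cl}^*(\mathfrak{V}_\varphi)\}$. -}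

module Defs where

open import Data.Nat using (ℕ)
open import Data.Unit using (⊤)
open import Data.Empty using (⊥)
open import Data.Product using (Σ; _×_; _,_)
open import Data.List using (List)
open import Data.List.Relation.Unary.All using (All)
open import Relation.Binary.PropositionalEquality using (_≡_; _≢_)
open import Relation.Binary.Structures using (IsTotalOrder)

record LinOrder : Set₁ where
  field
    Carrier      : Set
    _≤_          : Carrier → Carrier → Set
    isTotalOrder : IsTotalOrder _≡_ _≤_

  _<_ : Carrier → Carrier → Set
  x < y = x ≤ y × x ≢ y

data Sem : Set where
  reflexive   : Sem
  irreflexive : Sem

cmp : (O : LinOrder) → Sem → LinOrder.Carrier O → LinOrder.Carrier O → Set
cmp O reflexive   x y = LinOrder._≤_ O x y
cmp O irreflexive x y = LinOrder._<_ O x y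

data IRel : Set where
  A B E D L O A⁻ B⁻ E⁻ D⁻ L⁻ O⁻ : IRel

Rel : (𝔗 : LinOrder) → Sem → IRel → (x₁ y₁ x₂ y₂ : LinOrder.Carrier 𝔗) → Set
Rel 𝔗 s A  x₁ y₁ x₂ y₂ = (y₁ ≡ x₂) × cmp 𝔗 s x₂ y₂
Rel 𝔗 s B  x₁ y₁ x₂ y₂ = (x₁ ≡ x₂) × cmp 𝔗 s y₂ y₁
Rel 𝔗 s E  x₁ y₁ x₂ y₂ = cmp 𝔗 s x₁ x₂ × (y₁ ≡ y₂)
Rel 𝔗 s D  x₁ y₁ x₂ y₂ = cmp 𝔗 s x₁ x₂ × cmp 𝔗 s y₂ y₁
Rel 𝔗 s L  x₁ y₁ x₂ y₂ = cmp 𝔗 s y₁ x₂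
Rel 𝔗 s O  x₁ y₁ x₂ y₂ = cmp 𝔗 s x₁ x₂ × cmp 𝔗 s x₂ y₁ × cmp 𝔗 s y₁ y₂
Rel 𝔗 s A⁻ x₁ y₁ x₂ y₂ = (y₂ ≡ x₁) × cmp 𝔗 s x₂ y₂
Rel 𝔗 s B⁻ x₁ y₁ x₂ y₂ = (x₁ ≡ x₂) × cmp 𝔗 s y₁ y₂
Rel 𝔗 s E⁻ x₁ y₁ x₂ y₂ = cmp 𝔗 s x₂ x₁ × (y₁ ≡ y₂)
Rel 𝔗 s D⁻ x₁ y₁ x₂ y₂ = cmp 𝔗 s x₂ x₁ × cmp 𝔗 s y₁ y₂
Rel 𝔗 s L⁻ x₁ y₁ x₂ y₂ = cmp 𝔗 s y₂ x₁
Rel 𝔗 s O⁻ x₁ y₁ x₂ y₂ = cmp 𝔗 s x₂ x₁ × cmp 𝔗 s x₁ y₂ × cmp 𝔗 s y₂ y₁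

Var : Set
Var = ℕ

data Lit : Set where
  ⊤ₗ  : Lit
  ⊥ₗ  : Lit
  var : Var → Lit
  ⟨_⟩_ : IRel → Lit → Lit
  [_]_ : IRel → Lit → Lit

data Formula : Set where
  initial : Lit → Formula
  clause  : List Lit → Lit → Formula      -- [U](λ₁ ∧ … ∧ λₖ → λ)
  _∧ᶠ_    : Formula → Formula → Formula

data BoxLit : Lit → Set where
  ⊤ₗ  : BoxLit ⊤ₗ
  ⊥ₗ  : BoxLit ⊥ₗ
  var : ∀ p → BoxLit (var p)
  box : ∀ R {l} → BoxLit l → BoxLit ([ R ] l)

data BoxFormula : Formula → Set where
  initial : ∀ {l} → BoxLit l → BoxFormula (initial l)
  clause  : ∀ {ls l} → All BoxLit ls → BoxLit l → BoxFormula (clause ls l)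
  _∧ᶠ_    : ∀ {φ ψ} → BoxFormula φ → BoxFormula ψ → BoxFormula (φ ∧ᶠ ψ)

data InitialOf : Lit → Formula → Set where
  here  : ∀ {l} → InitialOf l (initial l)
  left  : ∀ {l φ ψ} → InitialOf l φ → InitialOf l (φ ∧ᶠ ψ)
  right : ∀ {l φ ψ} → InitialOf l ψ → InitialOf l (φ ∧ᶠ ψ)

data ClauseOf : List Lit → Lit → Formula → Set where
  here  : ∀ {ls l} → ClauseOf ls l (clause ls l)
  left  : ∀ {ls l φ ψ} → ClauseOf ls l φ → ClauseOf ls l (φ ∧ᶠ ψ)
  right : ∀ {ls l φ ψ} → ClauseOf ls l ψ → ClauseOf ls l (φ ∧ᶠ ψ)

data SubLit (k : Lit) : Lit → Set where
  here : SubLit k k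
  dia  : ∀ {R l} → SubLit k l → SubLit k (⟨ R ⟩ l)
  box  : ∀ {R l} → SubLit k l → SubLit k ([ R ] l)

data Any' (P : Lit → Set) : List Lit → Set where
  here  : ∀ {l ls} → P l → Any' P (l Data.List.∷ ls)
  there : ∀ {l ls} → Any' P ls → Any' P (l Data.List.∷ ls)

data OccursIn (k : Lit) : Formula → Set where
  initial : ∀ {l} → SubLit k l → OccursIn k (initial l)
  premise : ∀ {ls l} → Any' (SubLit k) ls → OccursIn k (clause ls l)
  concl   : ∀ {ls l} → SubLit k l → OccursIn k (clause ls l)
  left    : ∀ {φ ψ} → OccursIn k φ → OccursIn k (φ ∧ᶠ ψ)
  right   : ∀ {φ ψ} → OccursIn k ψ → OccursIn k (φ ∧ᶠ ψ)

-- Semantics.  A model based on 𝔗(⊲) is a valuation ν; ν p x y is the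
-- proposition "⟨x,y⟩ ∈ ν(p)" (only its values on intervals x ≤ y matter).

Valuation : LinOrder → Set₁
Valuation 𝔗 = Var → LinOrder.Carrier 𝔗 → LinOrder.Carrier 𝔗 → Set

module _ (𝔗 : LinOrder) (s : Sem) (ν : Valuation 𝔗) where
  open LinOrder 𝔗

  SatL : Lit → Carrier → Carrier → Set
  SatL ⊤ₗ        x y = ⊤
  SatL ⊥ₗ        x y = ⊥
  SatL (var p)   x y = ν p x y
  SatL (⟨ R ⟩ l) x y = Σ Carrier λ x' → Σ Carrier λ y' →
                         x' ≤ y' × Rel 𝔗 s R x y x' y' × SatL l x' y'
  SatL ([ R ] l) x y = ∀ x' y' → x' ≤ y' → Rel 𝔗 s R x y x' y' → SatL l x' y'

  Sat : Formula → Carrier → Carrier → Set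
  Sat (initial l)   x y = SatL l x y
  Sat (clause ls l) x y = ∀ x' y' → x' ≤ y' → All (λ k → SatL k x' y') ls → SatL l x' y'
  Sat (φ ∧ᶠ ψ)      x y = Sat φ x y × Sat ψ x y

Satisfiable : (𝔗 : LinOrder) → Sem → Formula → (a b : LinOrder.Carrier 𝔗) → Set₁
Satisfiable 𝔗 s φ a b = Σ (Valuation 𝔗) λ ν → Sat 𝔗 s ν φ a b

-- The closure cl*(𝔙_φ): λ @ ⟨x,y⟩ ∈ cl*(𝔙_φ) is the least set containing
-- 𝔙_φ and closed under (cl1)-(cl3), given as an inductive family.

data Cl (𝔗 : LinOrder) (s : Sem) (φ : Formula) (a b : LinOrder.Carrier 𝔗)
        : Lit → LinOrder.Carrier 𝔗 → LinOrder.Carrier 𝔗 → Set where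
  init : ∀ {l} → InitialOf l φ → Cl 𝔗 s φ a b l a b
  top  : ∀ {x y} → LinOrder._≤_ 𝔗 x y → Cl 𝔗 s φ a b ⊤ₗ x y
  cl1  : ∀ {R l x y x' y'} → Cl 𝔗 s φ a b ([ R ] l) x y →
         LinOrder._≤_ 𝔗 x' y' → Rel 𝔗 s R x y x' y' → Cl 𝔗 s φ a b l x' y'
  cl2  : ∀ {R l x y} → OccursIn ([ R ] l) φ → LinOrder._≤_ 𝔗 x y →
         (∀ x' y' → LinOrder._≤_ 𝔗 x' y' → Rel 𝔗 s R x y x' y' → Cl 𝔗 s φ a b l x' y') →
         Cl 𝔗 s φ a b ([ R ] l) x y
  cl3  : ∀ {ls l x y} → ClauseOf ls l φ → LinOrder._≤_ 𝔗 x y →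
         All (λ k → Cl 𝔗 s φ a b k x y) ls → Cl 𝔗 s φ a b l x y

K : (𝔗 : LinOrder) → Sem → Formula → (a b : LinOrder.Carrier 𝔗) → Valuation 𝔗
K 𝔗 s φ a b p x y = Cl 𝔗 s φ a b (var p) x y

-- Every model of φ at ⟨a,b⟩ contains cl*(𝔙_φ), since each closure rule is sound; so ⊥ is
-- never derived when φ is satisfiable, and 𝔎 is below every model. Conversely, if ⊥ is
-- never derived, 𝔎 satisfies φ: a box-literal derived in cl* holds in 𝔎 by (cl1), and a
-- box-literal of φ true in 𝔎 is derived by (cl2), so every clause of φ transfers from 𝔎 to
-- cl* and back. Diamonds are excluded because the closure never produces witnesses.
module Submission where

open import Defs
open import Data.Product using (_×_; _,_)
open import Relation.Nullary using (¬_)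
open import Data.Unit using (tt)
open import Data.List.Relation.Unary.All using (All; []; _∷_)

SubLit-box⁻ : ∀ {R k l} → SubLit ([ R ] k) l → SubLit k l
SubLit-box⁻ here    = box here
SubLit-box⁻ (dia p) = dia (SubLit-box⁻ p)
SubLit-box⁻ (box p) = box (SubLit-box⁻ p)

Any'-map : ∀ {P Q : Lit → Set} → (∀ {k} → P k → Q k) → ∀ {ls} → Any' P ls → Any' Q ls
Any'-map f (here p)  = here (f p)
Any'-map f (there p) = there (Any'-map f p)

OccursIn-box⁻ : ∀ {R k φ} → OccursIn ([ R ] k) φ → OccursIn k φ
OccursIn-box⁻ (initial p) = initial (SubLit-box⁻ p)
OccursIn-box⁻ (premise p) = premise (Any'-map SubLit-box⁻ p)
OccursIn-box⁻ (concl p)   = concl (SubLit-box⁻ p)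
OccursIn-box⁻ (left p)    = left (OccursIn-box⁻ p)
OccursIn-box⁻ (right p)   = right (OccursIn-box⁻ p)

record _≼_ (ψ φ : Formula) : Set where
  field
    initial⁺ : ∀ {l} → InitialOf l ψ → InitialOf l φ
    clause⁺  : ∀ {ls l} → ClauseOf ls l ψ → ClauseOf ls l φ
    occurs⁺  : ∀ {k} → OccursIn k ψ → OccursIn k φ

≼-refl : ∀ {φ} → φ ≼ φ
≼-refl = record { initial⁺ = λ i → i ; clause⁺ = λ c → c ; occurs⁺ = λ o → o }

∧ᶠ-≼ˡ : ∀ {ψ χ φ} → (ψ ∧ᶠ χ) ≼ φ → ψ ≼ φ
∧ᶠ-≼ˡ h = record { initial⁺ = λ i → initial⁺ (left i)
                 ; clause⁺  = λ c → clause⁺ (left c)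
                 ; occurs⁺  = λ o → occurs⁺ (left o) }
  where open _≼_ h

∧ᶠ-≼ʳ : ∀ {ψ χ φ} → (ψ ∧ᶠ χ) ≼ φ → χ ≼ φ
∧ᶠ-≼ʳ h = record { initial⁺ = λ i → initial⁺ (right i)
                 ; clause⁺  = λ c → clause⁺ (right c)
                 ; occurs⁺  = λ o → occurs⁺ (right o) }
  where open _≼_ h

module _ (𝔗 : LinOrder) (s : Sem) where
  open LinOrder 𝔗

  Sat-initial : ∀ {ν ψ l x y} → Sat 𝔗 s ν ψ x y → InitialOf l ψ → SatL 𝔗 s ν l x y
  Sat-initial h       here      = h
  Sat-initial (h , _) (left i)  = Sat-initial h i
  Sat-initial (_ , h) (right i) = Sat-initial h i

  Sat-clause : ∀ {ν ψ ls l x y} → Sat 𝔗 s ν ψ x y → ClauseOf ls l ψ →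
               Sat 𝔗 s ν (clause ls l) x y
  Sat-clause h       here      = h
  Sat-clause (h , _) (left c)  = Sat-clause h c
  Sat-clause (_ , h) (right c) = Sat-clause h c

  module _ (φ : Formula) (a b : Carrier) where

    Consistent : Set
    Consistent = ∀ x y → x ≤ y → ¬ Cl 𝔗 s φ a b ⊥ₗ x y

    module _ {ν : Valuation 𝔗} (ν⊨φ : Sat 𝔗 s ν φ a b) where

      Cl-sound : ∀ {l x y} → Cl 𝔗 s φ a b l x y → SatL 𝔗 s ν l x y
      Cl-sound-All : ∀ {ls x y} → All (λ k → Cl 𝔗 s φ a b k x y) ls →
                     All (λ k → SatL 𝔗 s ν k x y) ls

      Cl-sound (init i)       = Sat-initial ν⊨φ i
      Cl-sound (top _)        = tt
      Cl-sound (cl1 c x≤y r)  = Cl-sound c _ _ x≤y r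
      Cl-sound (cl2 _ _ f)    = λ x' y' x'≤y' r → Cl-sound (f x' y' x'≤y' r)
      Cl-sound (cl3 c x≤y cs) = Sat-clause ν⊨φ c _ _ x≤y (Cl-sound-All cs)

      Cl-sound-All []       = []
      Cl-sound-All (c ∷ cs) = Cl-sound c ∷ Cl-sound-All cs

      satisfiable⇒consistent : Consistent
      satisfiable⇒consistent _ _ _ = Cl-sound

    𝔎 : Valuation 𝔗
    𝔎 = K 𝔗 s φ a b

    Cl⇒Sat𝔎 : Consistent → ∀ {l} → BoxLit l → ∀ {x y} → x ≤ y →
              Cl 𝔗 s φ a b l x y → SatL 𝔗 s 𝔎 l x y
    Cl⇒Sat𝔎 _    ⊤ₗ         _   _ = tt
    Cl⇒Sat𝔎 cons ⊥ₗ         x≤y c = cons _ _ x≤y c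
    Cl⇒Sat𝔎 _    (var p)    _   c = c
    Cl⇒Sat𝔎 cons (box R bl) _   c = λ x' y' x'≤y' r → Cl⇒Sat𝔎 cons bl x'≤y' (cl1 c x'≤y' r)

    Sat𝔎⇒Cl : ∀ {l} → BoxLit l → OccursIn l φ → ∀ {x y} → x ≤ y →
              SatL 𝔗 s 𝔎 l x y → Cl 𝔗 s φ a b l x y
    Sat𝔎⇒Cl ⊤ₗ         _ x≤y _ = top x≤y
    Sat𝔎⇒Cl ⊥ₗ         _ _   ()
    Sat𝔎⇒Cl (var p)    _ _   h = h
    Sat𝔎⇒Cl (box R bl) o x≤y h =
      cl2 o x≤y λ x' y' x'≤y' r → Sat𝔎⇒Cl bl (OccursIn-box⁻ o) x'≤y' (h x' y' x'≤y' r)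

    Sat𝔎⇒Cl-All : ∀ {ls} → All BoxLit ls → (∀ {k} → Any' (SubLit k) ls → OccursIn k φ) →
                  ∀ {x y} → x ≤ y → All (λ k → SatL 𝔗 s 𝔎 k x y) ls →
                  All (λ k → Cl 𝔗 s φ a b k x y) ls
    Sat𝔎⇒Cl-All []         _   _   []       = []
    Sat𝔎⇒Cl-All (bl ∷ bls) occ x≤y (h ∷ hs) =
      Sat𝔎⇒Cl bl (occ (here here)) x≤y h ∷ Sat𝔎⇒Cl-All bls (λ p → occ (there p)) x≤y hs

    𝔎-sat-≼ : Consistent → a ≤ b → ∀ {ψ} → BoxFormula ψ → ψ ≼ φ → Sat 𝔗 s 𝔎 ψ a b
    𝔎-sat-≼ cons a≤b (initial bl) ψ≼φ = Cl⇒Sat𝔎 cons bl a≤b (init (_≼_.initial⁺ ψ≼φ here))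
    𝔎-sat-≼ cons _   (clause bls bl) ψ≼φ = λ x y x≤y hs →
      Cl⇒Sat𝔎 cons bl x≤y (cl3 (clause⁺ here) x≤y
        (Sat𝔎⇒Cl-All bls (λ p → occurs⁺ (premise p)) x≤y hs))
      where open _≼_ ψ≼φ
    𝔎-sat-≼ cons a≤b (bψ ∧ᶠ bχ) ψ≼φ =
      𝔎-sat-≼ cons a≤b bψ (∧ᶠ-≼ˡ ψ≼φ) , 𝔎-sat-≼ cons a≤b bχ (∧ᶠ-≼ʳ ψ≼φ)

    𝔎-sat : Consistent → a ≤ b → BoxFormula φ → Sat 𝔗 s 𝔎 φ a b
    𝔎-sat cons a≤b bφ = 𝔎-sat-≼ cons a≤b bφ ≼-refl

theorem3p2 : (𝔗 : LinOrder) (s : Sem) (a b : LinOrder.Carrier 𝔗) →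
    LinOrder._≤_ 𝔗 a b → (φ : Formula) → BoxFormula φ →
    ((Satisfiable 𝔗 s φ a b →
        (∀ x y → LinOrder._≤_ 𝔗 x y → ¬ Cl 𝔗 s φ a b ⊥ₗ x y))
     × ((∀ x y → LinOrder._≤_ 𝔗 x y → ¬ Cl 𝔗 s φ a b ⊥ₗ x y) →
        Satisfiable 𝔗 s φ a b))
    × ((ν : Valuation 𝔗) → Sat 𝔗 s ν φ a b →
        Sat 𝔗 s (K 𝔗 s φ a b) φ a b
        × (∀ x y → LinOrder._≤_ 𝔗 x y → (p : Var) →
             SatL 𝔗 s (K 𝔗 s φ a b) (var p) x y → SatL 𝔗 s ν (var p) x y))
theorem3p2 𝔗 s a b a≤b φ bφ =
  ( (λ (ν , ν⊨φ) → satisfiable⇒consistent 𝔗 s φ a b ν⊨φ)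
  , (λ cons → K 𝔗 s φ a b , 𝔎-sat 𝔗 s φ a b cons a≤b bφ) )
  , λ ν ν⊨φ →
      𝔎-sat 𝔗 s φ a b (satisfiable⇒consistent 𝔗 s φ a b ν⊨φ) a≤b bφ
    , λ _ _ _ _ → Cl-sound 𝔗 s φ a b ν⊨φ
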